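{- Let $v \geq 3$. Suppose that there exists a Kirkman triple system of order $3v$ which has an equitable $3$-colouring. Then there exists a Kirkman triple system of order $9v$ which has an equitable $3$-colouring.
   Context: A Kirkman triple system KTS$(n)$ is a Steiner triple system on $n$ points (every pair of points in exactly one triple) together with a partition of its triples into parallel classes (sets of triples partitioning the point set). A $3$-colouring is a map from the points to a set of $3$ colours such that no triple is monochromatic. A colouring is equitable if the sizes of its colour classes differ pairwise by at most one. -}

module Defs where

open import Data.Nat using (ℕ; _≤_; _+_)
open import Data.Fin using (Fin)
open import Data.Product using (Σ; _×_; _,_; ∃; ∃-syntax)
open import Data.Sum using (_⊎_)
open import Relation.Binary.PropositionalEquality using (_≡_; _≢_)
open import Relation.Nullary using (¬_)
open import Data.Fin.Subset using (Subset; ∣_∣)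
open import Data.Vec using (tabulate)
open import Data.Bool using (Bool)

record Triple (n : ℕ) : Set where
  constructor triple
  field
    p₁ p₂ p₃ : Fin n
    d₁₂ : p₁ ≢ p₂
    d₁₃ : p₁ ≢ p₃
    d₂₃ : p₂ ≢ p₃
open Triple public

_∈ₜ_ : ∀ {n} → Fin n → Triple n → Set
x ∈ₜ t = (x ≡ p₁ t) ⊎ (x ≡ p₂ t) ⊎ (x ≡ p₃ t)

∃!′ : ∀ {A : Set} → (A → Set) → Set
∃!′ {A} P = Σ A λ a → P a × (∀ b → P b → b ≡ a)

-- A Kirkman triple system on the points Fin n: r parallel classes,
-- each consisting of m triples, with blocks indexed by (class, position).
record KTS (n : ℕ) : Set where
  field
    r m : ℕ
    block : Fin r → Fin m → Triple n
    steiner : ∀ (x y : Fin n) → x ≢ y →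
      ∃!′ {Fin r × Fin m} (λ { (i , j) → (x ∈ₜ block i j) × (y ∈ₜ block i j) })
    parallel : ∀ (i : Fin r) (x : Fin n) → ∃!′ {Fin m} (λ j → x ∈ₜ block i j)

classSize : ∀ {n} → (Fin n → Fin 3) → Fin 3 → ℕ
classSize {n} c k = ∣ tabulate (λ x → isColour (c x)) ∣
  where
  open import Data.Fin using (_≟_)
  open import Relation.Nullary.Decidable using (⌊_⌋)
  isColour : Fin 3 → Bool
  isColour a = ⌊ a ≟ k ⌋

Proper3Colouring : ∀ {n} → KTS n → (Fin n → Fin 3) → Set
Proper3Colouring S c = ∀ i j →
  ¬ (c (p₁ (KTS.block S i j)) ≡ c (p₂ (KTS.block S i j)) ×
     c (p₂ (KTS.block S i j)) ≡ c (p₃ (KTS.block S i j)))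

Equitable : ∀ {n} → (Fin n → Fin 3) → Set
Equitable c = ∀ a b → classSize c a ≤ classSize c b + 1

HasEquitable3Colouring : ∀ {n} → KTS n → Set
HasEquitable3Colouring S = ∃[ c ] (Proper3Colouring S c × Equitable c)

-- Triple the point set: the points are pairs (a , x) of a level a ∈ ℤ₃ and a point x
-- of the given KTS(u).  The "vertical" triples {0,1,2} × {x} form one parallel class.
-- Every parallel class of the KTS(u) and every s ∈ ℤ₃ give a further class of
-- "horizontal" triples {(level π a s , xπ) | π ∈ ℤ₃}, one for each block {x₀,x₁,x₂}
-- and each a ∈ ℤ₃, where the nine rows π ↦ level π a s form a resolvable orthogonal
-- array of strength 2 over ℤ₃ without constant rows.  Colouring each point by its level
-- is then proper (vertical triples are rainbow, horizontal ones follow non-constant rows)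
-- with three classes of size u.
module Submission where

open import Defs
open import Data.Bool using (Bool; true; false; if_then_else_)
open import Data.Empty using (⊥-elim)
open import Data.Fin using (Fin; zero; suc; toℕ; _≟_; combine; remQuot; _↑ˡ_; _↑ʳ_)
open import Data.Fin.Patterns using (0F; 1F; 2F)
open import Data.Fin.Properties
  using (all?; any?; 0≢1+n; suc-injective; remQuot-combine; 1↔⊤; +↔⊎; *↔×)
open import Data.Fin.Subset using (∣_∣)
open import Data.Nat as ℕ using (ℕ; _≤_; _+_; _*_; s≤s)
open import Data.Nat.DivMod using (_mod_)
open import Data.Nat.Properties using (*-assoc; *-identityˡ; m≤m+n)
open import Data.Product using (_×_; uncurry; _,_; proj₁; ∃; ∃₂; ∃-syntax)
open import Data.Product.Properties using (,-injective; ,-injectiveˡ; ,-injectiveʳ)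
open import Data.Product.Function.NonDependent.Propositional using (_×-↔_; _×-⇔_)
open import Data.Sum using (_⊎_; inj₁; inj₂)
open import Data.Sum.Function.Propositional using (_⊎-↔_)
open import Data.Unit using (⊤; tt)
open import Data.Vec using (Vec; _∷_; tabulate)
open import Data.Vec.Properties using (tabulate-cong)
open import Function using (_∘_; case_of_)
open import Function.Bundles using (_↔_; _⇔_; Inverse; Injection; Equivalence; mk⇔)
open import Function.Construct.Composition using (_⇔-∘_)
open import Function.Definitions using (Injective)
open import Function.Properties.Inverse using (↔-sym; ↔-trans; ↔⇒↣)
open import Relation.Binary.PropositionalEquality
open import Relation.Nullary using (¬_; yes; no)
open import Relation.Nullary.Decidable using (_×-dec_; _→-dec_; ¬?; toWitness; ⌊_⌋)

-- level π a s = a + π s + π² in ℤ₃.  For p ≢ q the map (a , s) ↦ (level p a s , level q a s)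
-- is affine with invertible linear part (p − q ≢ 0), and the term π² leaves no row constant.
level : Fin 3 → Fin 3 → Fin 3 → Fin 3
level π a s = (toℕ a + toℕ π * toℕ s + toℕ π * toℕ π) mod 3

Monochromatic : ∀ {A : Set} → (Fin 3 → A) → Set
Monochromatic f = f 0F ≡ f 1F × f 1F ≡ f 2F

Monochromatic-resp-≗ : ∀ {A : Set} {f g : Fin 3 → A} → f ≗ g → Monochromatic f → Monochromatic g
Monochromatic-resp-≗ f≗g (e₁ , e₂) =
  trans (sym (f≗g 0F)) (trans e₁ (f≗g 1F)) , trans (sym (f≗g 1F)) (trans e₂ (f≗g 2F))

level-solve₁ : ∀ π s α → ∃ λ a → level π a s ≡ α
level-solve₁ = toWitness {a? = all? λ π → all? λ s → all? λ α → any? λ a → level π a s ≟ α} _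

level-injective₁ : ∀ π s {a a′} → level π a s ≡ level π a′ s → a ≡ a′
level-injective₁ π s {a} {a′} = toWitness {a? = all? λ π → all? λ s → all? λ a → all? λ a′ →
  (level π a s ≟ level π a′ s) →-dec (a ≟ a′)} _ π s a a′

level-solve₂ : ∀ {p q} → p ≢ q → ∀ α β → ∃₂ λ a s → level p a s ≡ α × level q a s ≡ β
level-solve₂ {p} {q} = toWitness {a? = all? λ p → all? λ q → ¬? (p ≟ q) →-dec
  (all? λ α → all? λ β → any? λ a → any? λ s → (level p a s ≟ α) ×-dec (level q a s ≟ β))} _ p q

level-injective₂ : ∀ {p q} → p ≢ q → ∀ {a s a′ s′} →
  level p a s ≡ level p a′ s′ → level q a s ≡ level q a′ s′ → a ≡ a′ × s ≡ s′
level-injective₂ {p} {q} p≢q {a} {s} {a′} {s′} =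
  toWitness {a? = all? λ p → all? λ q → ¬? (p ≟ q) →-dec
  (all? λ a → all? λ s → all? λ a′ → all? λ s′ → (level p a s ≟ level p a′ s′) →-dec
    ((level q a s ≟ level q a′ s′) →-dec ((a ≟ a′) ×-dec (s ≟ s′))))} _ p q p≢q a s a′ s′

level-nonmonochromatic : ∀ a s → ¬ Monochromatic (λ π → level π a s)
level-nonmonochromatic = toWitness {a? = all? λ a → all? λ s →
  ¬? ((level 0F a s ≟ level 1F a s) ×-dec (level 1F a s ≟ level 2F a s))} _

∃!′-↔ : ∀ {A B : Set} (e : A ↔ B) {P : B → Set} {Q : A → Set} →
  (∀ {a} → Q a ⇔ P (Inverse.to e a)) → ∃!′ P → ∃!′ Q
∃!′-↔ e {P} Q⇔P (b , Pb , unique) =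
  from b , Q⇔P.from (subst P (sym (strictlyInverseˡ b)) Pb) ,
  λ a Qa → sym (inverseʳ (sym (unique (to a) (Q⇔P.to Qa))))
  where
  open Inverse e
  module Q⇔P {a} = Equivalence (Q⇔P {a})

_∈ᵇ_ : ∀ {P : Set} → P → (Fin 3 → P) → Set
x ∈ᵇ b = ∃ λ π → x ≡ b π

point : ∀ {n} → Triple n → Fin 3 → Fin n
point t 0F = p₁ t
point t 1F = p₂ t
point t 2F = p₃ t

point-injective : ∀ {n} (t : Triple n) → Injective _≡_ _≡_ (point t)
point-injective t {0F} {0F} _ = refl
point-injective t {0F} {1F} e = ⊥-elim (d₁₂ t e)
point-injective t {0F} {2F} e = ⊥-elim (d₁₃ t e)
point-injective t {1F} {0F} e = ⊥-elim (d₁₂ t (sym e))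
point-injective t {1F} {1F} _ = refl
point-injective t {1F} {2F} e = ⊥-elim (d₂₃ t e)
point-injective t {2F} {0F} e = ⊥-elim (d₁₃ t (sym e))
point-injective t {2F} {1F} e = ⊥-elim (d₂₃ t (sym e))
point-injective t {2F} {2F} _ = refl

∈ₜ⇔∈ᵇ : ∀ {n} {t : Triple n} {b : Fin 3 → Fin n} → point t ≗ b → ∀ {x} → x ∈ₜ t ⇔ x ∈ᵇ b
∈ₜ⇔∈ᵇ {t = t} {b} point≗b {x} = mk⇔ to from
  where
  to : x ∈ₜ t → x ∈ᵇ b
  to (inj₁ e)        = 0F , trans e (point≗b 0F)
  to (inj₂ (inj₁ e)) = 1F , trans e (point≗b 1F)
  to (inj₂ (inj₂ e)) = 2F , trans e (point≗b 2F)
  from : x ∈ᵇ b → x ∈ₜ t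
  from (0F , e) = inj₁ (trans e (sym (point≗b 0F)))
  from (1F , e) = inj₂ (inj₁ (trans e (sym (point≗b 1F))))
  from (2F , e) = inj₂ (inj₂ (trans e (sym (point≗b 2F))))

∈ₜ⇔∈-point : ∀ {n} {t : Triple n} {x} → x ∈ₜ t ⇔ x ∈ᵇ point t
∈ₜ⇔∈-point = ∈ₜ⇔∈ᵇ λ _ → refl

tripleOf : ∀ {n} (b : Fin 3 → Fin n) → Injective _≡_ _≡_ b → Triple n
tripleOf b inj = triple (b 0F) (b 1F) (b 2F)
  (λ e → 0≢1+n (inj e)) (λ e → 0≢1+n (inj e)) (λ e → 0≢1+n (suc-injective (inj e)))

point-tripleOf : ∀ {n} (b : Fin 3 → Fin n) (inj : Injective _≡_ _≡_ b) → point (tripleOf b inj) ≗ b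
point-tripleOf b inj 0F = refl
point-tripleOf b inj 1F = refl
point-tripleOf b inj 2F = refl

record KirkmanSystem (Point Class Slot : Set) : Set where
  field
    block : Class → Slot → Fin 3 → Point
    block-injective : ∀ c σ → Injective _≡_ _≡_ (block c σ)
    steiner : ∀ x y → x ≢ y →
      ∃!′ {Class × Slot} λ (c , σ) → x ∈ᵇ block c σ × y ∈ᵇ block c σ
    parallel : ∀ c x → ∃!′ λ σ → x ∈ᵇ block c σ

module Relabel {Point Class Slot : Set} {n r m : ℕ}
  (points : Fin n ↔ Point) (classes : Fin r ↔ Class) (slots : Fin m ↔ Slot)
  (K : KirkmanSystem Point Class Slot) where

  open KirkmanSystem K
  module P = Inverse points
  module C = Inverse classes
  module M = Inverse slots

  relabelledPoints : Fin r → Fin m → Fin 3 → Fin n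
  relabelledPoints i j = P.from ∘ block (C.to i) (M.to j)

  relabelledPoints-injective : ∀ i j → Injective _≡_ _≡_ (relabelledPoints i j)
  relabelledPoints-injective i j = block-injective _ _ ∘ Injection.injective (↔⇒↣ (↔-sym points))

  relabelledBlock : Fin r → Fin m → Triple n
  relabelledBlock i j = tripleOf (relabelledPoints i j) (relabelledPoints-injective i j)

  ∈-relabelledBlock : ∀ {X i j} → X ∈ₜ relabelledBlock i j ⇔ P.to X ∈ᵇ block (C.to i) (M.to j)
  ∈-relabelledBlock = mk⇔ (λ (π , e) → π , P.inverseˡ e) (λ (π , e) → π , sym (P.inverseʳ (sym e)))
    ⇔-∘ ∈ₜ⇔∈ᵇ (point-tripleOf _ (relabelledPoints-injective _ _))

  relabelled : KTS n
  relabelled = record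
    { r = r
    ; m = m
    ; block = relabelledBlock
    ; steiner = λ X Y X≢Y → ∃!′-↔ (classes ×-↔ slots) (∈-relabelledBlock ×-⇔ ∈-relabelledBlock)
        (steiner (P.to X) (P.to Y) (X≢Y ∘ Injection.injective (↔⇒↣ points)))
    ; parallel = λ i X → ∃!′-↔ slots ∈-relabelledBlock (parallel (C.to i) (P.to X))
    }

  relabelled-proper : ∀ colour → (∀ c σ → ¬ Monochromatic (colour ∘ block c σ)) →
    Proper3Colouring relabelled (colour ∘ P.to)
  relabelled-proper colour proper i j = proper (C.to i) (M.to j) ∘ Monochromatic-resp-≗ recolour
    where
    recolour : colour ∘ P.to ∘ point (relabelledBlock i j) ≗ colour ∘ block (C.to i) (M.to j)
    recolour π = cong colour (trans (cong P.to (point-tripleOf _ (relabelledPoints-injective i j) π))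
      (P.strictlyInverseˡ _))

∣tabulate∣-++ : ∀ m {n} (f : Fin (m + n) → Bool) →
  ∣ tabulate f ∣ ≡ ∣ tabulate (f ∘ (_↑ˡ n)) ∣ + ∣ tabulate (f ∘ (m ↑ʳ_)) ∣
∣tabulate∣-++ ℕ.zero f = refl
∣tabulate∣-++ (ℕ.suc m) f with f zero
... | true  = cong ℕ.suc (∣tabulate∣-++ m (f ∘ suc))
... | false = ∣tabulate∣-++ m (f ∘ suc)

∣tabulate∣-const : ∀ n b → ∣ tabulate {n = n} (λ _ → b) ∣ ≡ (if b then n else 0)
∣tabulate∣-const ℕ.zero    true  = refl
∣tabulate∣-const ℕ.zero    false = refl
∣tabulate∣-const (ℕ.suc n) true  = cong ℕ.suc (∣tabulate∣-const n true)
∣tabulate∣-const (ℕ.suc n) false = ∣tabulate∣-const n false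

∣∷∣-* : ∀ b {k} (bs : Vec Bool k) n → ∣ b ∷ bs ∣ * n ≡ (if b then n else 0) + ∣ bs ∣ * n
∣∷∣-* true  bs n = refl
∣∷∣-* false bs n = refl

∣tabulate∣-combine : ∀ m {n} (f : Fin (m * n) → Bool) (g : Fin m → Bool) →
  (∀ i j → f (combine i j) ≡ g i) → ∣ tabulate f ∣ ≡ ∣ tabulate g ∣ * n
∣tabulate∣-combine ℕ.zero          f g f≡g = refl
∣tabulate∣-combine (ℕ.suc m) {n} f g f≡g = begin
  ∣ tabulate f ∣
    ≡⟨ ∣tabulate∣-++ n f ⟩
  ∣ tabulate (f ∘ (_↑ˡ m * n)) ∣ + ∣ tabulate (f ∘ (n ↑ʳ_)) ∣
    ≡⟨ cong₂ _+_ (trans (cong ∣_∣ (tabulate-cong (f≡g zero))) (∣tabulate∣-const n (g zero)))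
                 (∣tabulate∣-combine m (f ∘ (n ↑ʳ_)) (g ∘ suc) (f≡g ∘ suc)) ⟩
  (if g zero then n else 0) + ∣ tabulate (g ∘ suc) ∣ * n
    ≡⟨ ∣∷∣-* (g zero) (tabulate (g ∘ suc)) n ⟨
  ∣ tabulate g ∣ * n
    ∎
  where open ≡-Reasoning

module Tripling {u : ℕ} (S : KTS u) (i₀ : Fin (KTS.r S)) where

  open KTS S

  Point : Set
  Point = Fin 3 × Fin u

  Class : Set
  Class = ⊤ ⊎ (Fin r × Fin 3)

  Slot : Set
  Slot = Fin m × Fin 3

  position-unique : ∀ i x → ∃!′ {Fin m × Fin 3} λ (j , π) → x ≡ point (block i j) π
  position-unique i x with parallel i x
  ... | j , x∈ , unique with Equivalence.to ∈ₜ⇔∈-point x∈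
  ... | π , x≡ = (j , π) , x≡ , λ where
    (j′ , π′) x≡′ → case unique j′ (Equivalence.from ∈ₜ⇔∈-point (π′ , x≡′)) of λ where
      refl → cong (j ,_) (point-injective (block i j) (trans (sym x≡′) x≡))

  column : Slot → Fin u
  column (j , t) = point (block i₀ j) t

  tripledBlock : Class → Slot → Fin 3 → Point
  tripledBlock (inj₁ _)       σ       π = π , column σ
  tripledBlock (inj₂ (i , s)) (j , a) π = level π a s , point (block i j) π

  tripledBlock-injective : ∀ c σ → Injective _≡_ _≡_ (tripledBlock c σ)
  tripledBlock-injective (inj₁ _)       σ       = ,-injectiveˡ
  tripledBlock-injective (inj₂ (i , s)) (j , a) = point-injective (block i j) ∘ ,-injectiveʳ

  vertical-column : ∀ {a x σ} → (a , x) ∈ᵇ tripledBlock (inj₁ tt) σ → x ≡ column σ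
  vertical-column (_ , e) = ,-injectiveʳ e

  horizontal-meets-column-once : ∀ {a b x c σ} →
    (a , x) ∈ᵇ tripledBlock (inj₂ c) σ → (b , x) ∈ᵇ tripledBlock (inj₂ c) σ → a ≡ b
  horizontal-meets-column-once {c = i , s} {j , _} (π , e) (π′ , e′)
    with ,-injective e | ,-injective e′
  ... | a≡ , x≡ | b≡ , x≡′ with point-injective (block i j) {π} {π′} (trans (sym x≡) x≡′)
  ... | refl = trans a≡ (sym b≡)

  Joins : Point → Point → Class × Slot → Set
  Joins p q (c , σ) = p ∈ᵇ tripledBlock c σ × q ∈ᵇ tripledBlock c σ

  joins-same-column : ∀ {a b} x → a ≢ b → ∃!′ (Joins (a , x) (b , x))
  joins-same-column {a} {b} x a≢b with position-unique i₀ x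
  ... | σ , x≡ , unique = (inj₁ tt , σ) , ((a , cong (a ,_) x≡) , (b , cong (b ,_) x≡)) , λ where
    (inj₁ _ , σ′) (a∈ , _)  → cong (inj₁ tt ,_) (unique σ′ (vertical-column {σ = σ′} a∈))
    (inj₂ c , σ′) (a∈ , b∈) → ⊥-elim (a≢b (horizontal-meets-column-once {c = c} {σ′} a∈ b∈))

  joins-distinct-columns : ∀ {a b x y} → x ≢ y → ∃!′ (Joins (a , x) (b , y))
  joins-distinct-columns {a} {b} {x} {y} x≢y with steiner x y x≢y
  ... | (i , j) , (x∈ , y∈) , unique =
    through (Equivalence.to ∈ₜ⇔∈-point x∈) (Equivalence.to ∈ₜ⇔∈-point y∈)
    where
    t = block i j

    through : x ∈ᵇ point t → y ∈ᵇ point t → ∃!′ (Joins (a , x) (b , y))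
    through (πx , x≡) (πy , y≡) = lift (level-solve₂ πx≢πy a b)
      where
      πx≢πy : πx ≢ πy
      πx≢πy πx≡πy = x≢y (trans x≡ (trans (cong (point t) πx≡πy) (sym y≡)))

      lift : (∃₂ λ a′ s → level πx a′ s ≡ a × level πy a′ s ≡ b) → ∃!′ (Joins (a , x) (b , y))
      lift (a′ , s , ≡a , ≡b) =
        (inj₂ (i , s) , (j , a′)) , ((πx , cong₂ _,_ (sym ≡a) x≡) , (πy , cong₂ _,_ (sym ≡b) y≡)) , only
        where
        only : ∀ cσ → Joins (a , x) (b , y) cσ → cσ ≡ (inj₂ (i , s) , (j , a′))
        only (inj₁ _ , σ) (x∈′ , y∈′) =
          ⊥-elim (x≢y (trans (vertical-column {σ = σ} x∈′) (sym (vertical-column {σ = σ} y∈′))))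
        only (inj₂ (i′ , s′) , (j′ , a″)) ((π₁ , e₁) , (π₂ , e₂)) with ,-injective e₁ | ,-injective e₂
        ... | a≡ , x≡′ | b≡ , y≡′
          with unique (i′ , j′)
                 (Equivalence.from ∈ₜ⇔∈-point (π₁ , x≡′) , Equivalence.from ∈ₜ⇔∈-point (π₂ , y≡′))
        ... | refl with point-injective t {π₁} {πx} (trans (sym x≡′) x≡)
                      | point-injective t {π₂} {πy} (trans (sym y≡′) y≡)
        ... | refl | refl = uncurry (cong₂ λ a s → inj₂ (i , s) , (j , a))
          (level-injective₂ πx≢πy {a″} {s′} {a′} {s}
            (trans (sym a≡) (sym ≡a)) (trans (sym b≡) (sym ≡b)))

  tripled-parallel : ∀ c p → ∃!′ λ σ → p ∈ᵇ tripledBlock c σ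
  tripled-parallel (inj₁ _) (a , x) with position-unique i₀ x
  ... | σ , x≡ , unique = σ , (a , cong (a ,_) x≡) , λ σ′ p∈ → unique σ′ (vertical-column {σ = σ′} p∈)
  tripled-parallel (inj₂ (i , s)) (a , x) with position-unique i x
  ... | (j , π) , x≡ , unique with level-solve₁ π s a
  ... | a′ , ≡a = (j , a′) , (π , cong₂ _,_ (sym ≡a) x≡) , only
    where
    only : ∀ σ → (a , x) ∈ᵇ tripledBlock (inj₂ (i , s)) σ → σ ≡ (j , a′)
    only (j′ , a″) (π′ , e) with ,-injective e
    ... | a≡ , x≡′ with unique (j′ , π′) x≡′
    ... | refl = cong (j ,_) (level-injective₁ π s {a″} {a′} (trans (sym a≡) (sym ≡a)))

  tripled-steiner : ∀ p q → p ≢ q → ∃!′ (Joins p q)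
  tripled-steiner (a , x) (b , y) p≢q with x ≟ y
  ... | yes refl = joins-same-column x (p≢q ∘ cong (_, x))
  ... | no x≢y   = joins-distinct-columns x≢y

  tripled : KirkmanSystem Point Class Slot
  tripled = record
    { block = tripledBlock
    ; block-injective = tripledBlock-injective
    ; steiner = tripled-steiner
    ; parallel = tripled-parallel
    }

  levels-proper : ∀ c σ → ¬ Monochromatic (proj₁ ∘ tripledBlock c σ)
  levels-proper (inj₁ _)       σ       (() , _)
  levels-proper (inj₂ (i , s)) (j , a) = level-nonmonochromatic a s

  classes : Fin (1 + r * 3) ↔ Class
  classes = ↔-trans +↔⊎ (1↔⊤ ⊎-↔ *↔×)

  open Relabel *↔× classes *↔× tripled using (relabelled; relabelled-proper)

  levels : Fin (3 * u) → Fin 3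
  levels = proj₁ ∘ remQuot u

  levels-classSize : ∀ k → classSize levels k ≡ u
  levels-classSize k = trans
    (∣tabulate∣-combine 3 _ (λ a → ⌊ a ≟ k ⌋) λ a x →
      cong (λ p → ⌊ proj₁ p ≟ k ⌋) (remQuot-combine a x))
    (trans (cong (_* u) (∣⁅k⁆∣ k)) (*-identityˡ u))
    where
    ∣⁅k⁆∣ : ∀ k → ∣ tabulate (λ a → ⌊ a ≟ k ⌋) ∣ ≡ 1
    ∣⁅k⁆∣ 0F = refl
    ∣⁅k⁆∣ 1F = refl
    ∣⁅k⁆∣ 2F = refl

  levels-equitable : Equitable levels
  levels-equitable a b rewrite levels-classSize a | levels-classSize b = m≤m+n u 1

  tripledKTS : ∃[ T ] HasEquitable3Colouring {3 * u} T
  tripledKTS = relabelled , levels , relabelled-proper proj₁ levels-proper , levels-equitable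

aParallelClass : ∀ {n} (S : KTS (2 + n)) → Fin (KTS.r S)
aParallelClass S = proj₁ (proj₁ (KTS.steiner S zero (suc zero) λ ()))

theorem2p3 : (v : ℕ) → 3 ≤ v →
    ∃[ S ] HasEquitable3Colouring {3 * v} S →
    ∃[ T ] HasEquitable3Colouring {9 * v} T
theorem2p3 v (s≤s (s≤s (s≤s _))) (S , _) =
  subst (λ n → ∃[ T ] HasEquitable3Colouring {n} T) (sym (*-assoc 3 3 v))
    (Tripling.tripledKTS S (aParallelClass S))
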